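{- Let $(S,\to,\preceq)$ be a self-simulating transition system and let $I \subseteq S$ be a reachability invariant of it. Let $s_1, t_1 \in S$ with $s_1 \preceq t_1$ and $t_1 \in I$. If $s_1 \to s_2 \to \cdots \to s_n$ is a finite path in $\to$, then there is a path $t_1 \to_{\preceq} t_2 \to_{\preceq} \cdots \to_{\preceq} t_n$ such that $s_i \preceq t_i$ and $t_i \in I$ for all $i$. Similarly, if $s_1 \to s_2 \to \cdots$ is an infinite run in $\to$, then there is an infinite run $t_1 \to_{\preceq} t_2 \to_{\preceq} \cdots$ such that $s_i \preceq t_i$ and $t_i \in I$ for all $i$.
   Context: A transition system $(S,\to)$ consists of a set $S$ and a relation $\to\ \subseteq S\times S$; a path is a finite sequence $s_1\to s_2\to\cdots\to s_n$ and a run is an infinite sequence $s_1 \to s_2 \to \cdots$ with consecutive states related by $\to$. A self-simulating transition system (SSTS) $(S,\to,\preceq)$ is a transition system together with a quasi-order (reflexive and transitive relation) $\preceq$ on $S$ such that for all $s,s',t\in S$: if $s\preceq s'$ and $s\to t$, then there exists $t'$ with $s'\to t'$ and $t\preceq t'$. A set $I\subseteq S$ is a reachability invariant of the SSTS if for all $s\in I$ and all $t$ with $s\to t$ there exists $t'\in I$ with $t\preceq t'$. The relation $\to_{\preceq}$ on $S$ is defined by: $s\to_{\preceq} t'$ iff there exists $t$ with $s\to t$ and $t\preceq t'$. -}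

module Defs where

open import Level using (Level; _⊔_)
open import Data.Nat using (ℕ; zero; suc)
open import Data.Fin using (Fin; inject₁) renaming (suc to fsuc)
open import Data.Product using (Σ; ∃; _×_; _,_)
open import Relation.Binary.Core using (Rel)
open import Relation.Binary.Definitions using (Reflexive; Transitive)
open import Relation.Unary using (Pred; _∈_)

record IsQuasiOrder {a ℓ : Level} {S : Set a} (_≼_ : Rel S ℓ) : Set (a ⊔ ℓ) where
  field
    refl  : Reflexive _≼_
    trans : Transitive _≼_

record SSTS {a ℓ₁ ℓ₂ : Level} (S : Set a) (_⟶_ : Rel S ℓ₁) (_≼_ : Rel S ℓ₂)
       : Set (a ⊔ ℓ₁ ⊔ ℓ₂) where
  field
    quasiOrder : IsQuasiOrder _≼_
    simulate   : ∀ {s s′ t} → s ≼ s′ → s ⟶ t → ∃ λ t′ → (s′ ⟶ t′) × (t ≼ t′)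

IsReachInvariant : {a ℓ₁ ℓ₂ ℓ : Level} {S : Set a} → Rel S ℓ₁ → Rel S ℓ₂ → Pred S ℓ
                 → Set (a ⊔ ℓ₁ ⊔ ℓ₂ ⊔ ℓ)
IsReachInvariant {S = S} _⟶_ _≼_ I =
  ∀ {s t} → s ∈ I → s ⟶ t → ∃ λ t′ → (t′ ∈ I) × (t ≼ t′)

SimStep : {a ℓ₁ ℓ₂ : Level} {S : Set a} → Rel S ℓ₁ → Rel S ℓ₂ → Rel S (a ⊔ ℓ₁ ⊔ ℓ₂)
SimStep _⟶_ _≼_ s t′ = ∃ λ t → (s ⟶ t) × (t ≼ t′)

-- A finite path with n+1 states (indices 0..n), given as a function Fin (suc n) → S.
IsPath : {a ℓ : Level} {S : Set a} → Rel S ℓ → (n : ℕ) → (Fin (suc n) → S) → Set ℓ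
IsPath _R_ n p = (i : Fin n) → p (inject₁ i) R p (fsuc i)

IsRun : {a ℓ : Level} {S : Set a} → Rel S ℓ → (ℕ → S) → Set ℓ
IsRun _R_ r = (i : ℕ) → r i R r (suc i)

-- A state t dominates s when s ≼ t and t ∈ I. By self-simulation a step s ⟶ s′ from a
-- dominated state is matched by a step t ⟶ u with s′ ≼ u, and the invariant then moves u
-- up to some t′ ∈ I with u ≼ t′; so t ⟶≼ t′ and t′ dominates s′. Domination is thus a
-- forward simulation of ⟶ by ⟶≼, and any forward simulation lifts paths and runs step by step.
module Submission where

open import Defs
open import Level using (Level; _⊔_)
open import Data.Nat using (ℕ; zero; suc)
open import Data.Fin using (Fin; zero; suc)
open import Data.Vec.Functional using (_∷_)
open import Data.Product using (∃; _×_; _,_; proj₁; proj₂)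
open import Relation.Binary.Core using (REL; Rel)
open import Relation.Binary.PropositionalEquality using (_≡_; refl)
open import Relation.Unary using (Pred; _∈_)

ForwardSimulation : {a b ℓ₁ ℓ₂ ℓ : Level} {A : Set a} {B : Set b}
                  → Rel A ℓ₁ → Rel B ℓ₂ → REL A B ℓ → Set (a ⊔ b ⊔ ℓ₁ ⊔ ℓ₂ ⊔ ℓ)
ForwardSimulation _⟶_ _⟶′_ _R_ =
  ∀ {s s′ t} → s R t → s ⟶ s′ → ∃ λ t′ → (t ⟶′ t′) × (s′ R t′)

module _ {a b ℓ₁ ℓ₂ ℓ : Level} {A : Set a} {B : Set b}
         {_⟶_ : Rel A ℓ₁} {_⟶′_ : Rel B ℓ₂} {_R_ : REL A B ℓ}
         (simulation : ForwardSimulation _⟶_ _⟶′_ _R_) where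

  path-lift : (n : ℕ) (s : Fin (suc n) → A) {t₀ : B}
            → IsPath _⟶_ n s → s zero R t₀
            → ∃ λ (t : Fin (suc n) → B)
                → (t zero ≡ t₀) × IsPath _⟶′_ n t × ((i : Fin (suc n)) → s i R t i)
  path-lift zero s {t₀} path s₀Rt₀ = (λ _ → t₀) , refl , (λ ()) , λ { zero → s₀Rt₀ }
  path-lift (suc n) s {t₀} path s₀Rt₀
    with t₁ , t₀⟶t₁ , s₁Rt₁ ← simulation s₀Rt₀ (path zero)
    with t , refl , t-path , sRt ← path-lift n (λ i → s (suc i)) (λ i → path (suc i)) s₁Rt₁
    = t₀ ∷ t , refl , (λ { zero → t₀⟶t₁ ; (suc i) → t-path i })
    , λ { zero → s₀Rt₀ ; (suc i) → sRt i }

  run-lift : (s : ℕ → A) {t₀ : B}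
           → IsRun _⟶_ s → s 0 R t₀
           → ∃ λ (t : ℕ → B) → (t 0 ≡ t₀) × IsRun _⟶′_ t × ((i : ℕ) → s i R t i)
  run-lift s {t₀} run s₀Rt₀ = (λ i → proj₁ (lifted i)) , refl , step , λ i → proj₂ (lifted i)
    where
    lifted : (i : ℕ) → ∃ (s i R_)
    next : (i : ℕ) → ∃ λ t′ → (proj₁ (lifted i) ⟶′ t′) × (s (suc i) R t′)

    lifted zero    = t₀ , s₀Rt₀
    lifted (suc i) = proj₁ (next i) , proj₂ (proj₂ (next i))

    next i = simulation (proj₂ (lifted i)) (run i)

    step : IsRun _⟶′_ (λ i → proj₁ (lifted i))
    step i = proj₁ (proj₂ (next i))

Dominated : {a ℓ₂ ℓ : Level} {S : Set a} → Rel S ℓ₂ → Pred S ℓ → Rel S (ℓ₂ ⊔ ℓ)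
Dominated _≼_ I s t = (s ≼ t) × (t ∈ I)

dominated-forwardSimulation : {a ℓ₁ ℓ₂ ℓ : Level} {S : Set a} {_⟶_ : Rel S ℓ₁} {_≼_ : Rel S ℓ₂}
                            → SSTS S _⟶_ _≼_ → {I : Pred S ℓ} → IsReachInvariant _⟶_ _≼_ I
                            → ForwardSimulation _⟶_ (SimStep _⟶_ _≼_) (Dominated _≼_ I)
dominated-forwardSimulation ssts invariant (s≼t , t∈I) s⟶s′
  with u , t⟶u , s′≼u ← SSTS.simulate ssts s≼t s⟶s′
  with t′ , t′∈I , u≼t′ ← invariant t∈I t⟶u
  = t′ , (u , t⟶u , u≼t′) , IsQuasiOrder.trans (SSTS.quasiOrder ssts) s′≼u u≼t′ , t′∈I

theorem2 : {a ℓ₁ ℓ₂ ℓ : Level} {S : Set a} {_⟶_ : Rel S ℓ₁} {_≼_ : Rel S ℓ₂}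
    → SSTS S _⟶_ _≼_
    → (I : Pred S ℓ)
    → IsReachInvariant _⟶_ _≼_ I
    → ((n : ℕ) (s : Fin (suc n) → S) (t₁ : S)
         → s zero ≼ t₁ → t₁ ∈ I → IsPath _⟶_ n s
         → ∃ λ (t : Fin (suc n) → S)
             → (t zero ≡ t₁)
             × IsPath (SimStep _⟶_ _≼_) n t
             × ((i : Fin (suc n)) → (s i ≼ t i) × (t i ∈ I)))
      × ((s : ℕ → S) (t₁ : S)
         → s 0 ≼ t₁ → t₁ ∈ I → IsRun _⟶_ s
         → ∃ λ (t : ℕ → S)
             → (t 0 ≡ t₁)
             × IsRun (SimStep _⟶_ _≼_) t
             × ((i : ℕ) → (s i ≼ t i) × (t i ∈ I)))
theorem2 {_⟶_ = _⟶_} {_≼_} ssts I invariant =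
    (λ n s t₁ s₁≼t₁ t₁∈I path → path-lift {_R_ = Dominated _≼_ I} simulation n s path (s₁≼t₁ , t₁∈I))
  , (λ s t₁ s₁≼t₁ t₁∈I run → run-lift {_R_ = Dominated _≼_ I} simulation s run (s₁≼t₁ , t₁∈I))
  where
  simulation : ForwardSimulation _⟶_ (SimStep _⟶_ _≼_) (Dominated _≼_ I)
  simulation = dominated-forwardSimulation ssts invariant
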